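{- Let $n\ge0$ and let $\mathbf{k}$ be a commutative ring. The family $\{\mathbf{B}_{\operatorname{LRM}'(w)}\,w\mid w\in S_n\}$ is a basis of the $\mathbf{k}$-module $\mathbf{k}[S_n]$.
   Context: $S_n$ is the symmetric group on $[n]$, with product given by composition $(uw)(i)=u(w(i))$. $\operatorname{Des}(u)=\{i\in[n-1]\mid u(i)>u(i+1)\}$; for $I\subseteq[n-1]$, $\mathbf{B}_I=\sum_{u\in S_n,\ \operatorname{Des}(u)\subseteq I}u$. $\operatorname{LRM}(w)=\{i\in[n]\mid w(k)>i\text{ for all }k<w^{ -1}(i)\}$ and $\operatorname{LRM}'(w)=\{\ell-1\mid\ell\in\operatorname{LRM}(w),\ \ell>1\}$. -}

module Defs where

open import Level using (Level; _⊔_)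
open import Data.Bool using (Bool; true; false; _∧_; _∨_; not; if_then_else_)
open import Data.Nat using (ℕ; zero; suc; _<ᵇ_; _≤ᵇ_; _≡ᵇ_; _<?_; _∸_)
open import Data.Fin as Fin using (Fin; toℕ; fromℕ<)
open import Data.Vec as Vec using (Vec; []; _∷_; lookup; tabulate)
open import Data.Vec.Properties using (≡-dec)
open import Data.List as List using (List; []; _∷_; foldr; map; concatMap; filterᵇ; applyUpTo)
open import Data.List.Membership.Propositional using (_∈_)
open import Data.Product using (Σ; _×_)
open import Relation.Nullary using (yes; no)
open import Relation.Nullary.Decidable using (⌊_⌋)
open import Algebra.Bundles using (CommutativeRing)

-- Words / permutations of [n] in one-line notation.
-- A vector v : Vec (Fin n) n represents the map i ↦ 1 + toℕ (lookup v (i-1))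
-- on [n] = {1,…,n}.

Word : ℕ → Set
Word n = Vec (Fin n) n

all : {A : Set} → (A → Bool) → List A → Bool
all p []       = true
all p (x ∷ xs) = p x ∧ all p xs

oneTo : ℕ → List ℕ
oneTo m = applyUpTo suc m

-- value w(i) ∈ [n] for i ∈ [n] (1-based); 0 outside [n]
ev : ∀ {n} → Word n → ℕ → ℕ
ev w zero = 0
ev {n} w (suc j) with j <? n
... | yes p = suc (toℕ (lookup w (fromℕ< p)))
... | no _  = 0

-- w⁻¹(i): the (first) position k ∈ [n] with w(k) = i (0 if none)
posOf : ∀ {n} → Word n → ℕ → ℕ
posOf {n} w i = go (oneTo n)
  where
  go : List ℕ → ℕ
  go []       = 0
  go (k ∷ ks) = if ev w k ≡ᵇ i then k else go ks

allVec : ∀ {n} (m : ℕ) → List (Vec (Fin n) m)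
allVec zero    = [] ∷ []
allVec {n} (suc m) = concatMap (λ a → map (a ∷_) (allVec m)) (List.allFin n)

isPerm : ∀ {n} → Word n → Bool
isPerm {n} v = all (λ i → all (λ j → (toℕ i ≡ᵇ toℕ j) ∨ not (toℕ (lookup v i) ≡ᵇ toℕ (lookup v j)))
                              (List.allFin n))
                   (List.allFin n)

Sn : (n : ℕ) → List (Word n)
Sn n = filterᵇ isPerm (allVec n)

compose : ∀ {n} → Word n → Word n → Word n
compose u w = tabulate (λ i → lookup u (lookup w i))

_≟W_ : ∀ {n} (u w : Word n) → _
_≟W_ = ≡-dec Fin._≟_

-- Subsets of [n-1] as Boolean predicates on ℕ.

Des : ∀ {n} → Word n → ℕ → Bool
Des {n} u i = (1 ≤ᵇ i) ∧ (i ≤ᵇ n ∸ 1) ∧ (ev u (suc i) <ᵇ ev u i)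

DesSub : ∀ {n} → Word n → (ℕ → Bool) → Bool
DesSub {n} u I = all (λ i → not (Des u i) ∨ I i) (oneTo (n ∸ 1))

LRM : ∀ {n} → Word n → ℕ → Bool
LRM {n} w i = (1 ≤ᵇ i) ∧ (i ≤ᵇ n) ∧ all (λ k → i <ᵇ ev w k) (oneTo (posOf w i ∸ 1))

LRM' : ∀ {n} → Word n → ℕ → Bool
LRM' w i = (1 ≤ᵇ i) ∧ LRM w (suc i)

-- The group algebra k[S_n]: functions S_n → k (coefficient vectors w.r.t.
-- the standard basis S_n); only values on elements of Sn n matter.

module GroupAlgebra {c ℓ : Level} (R : CommutativeRing c ℓ) (n : ℕ) where
  open CommutativeRing R

  KS : Set c
  KS = Word n → Carrier

  sumSn : (Word n → Carrier) → Carrier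
  sumSn f = foldr (λ w acc → f w + acc) 0# (Sn n)

  _⋆_ : KS → KS → KS
  (f ⋆ g) u = sumSn (λ v → sumSn (λ w →
                 if ⌊ compose v w ≟W u ⌋ then f v * g w else 0#))

  δ : Word n → KS
  δ w u = if ⌊ u ≟W w ⌋ then 1# else 0#

  B : (ℕ → Bool) → KS
  B I u = if DesSub u I then 1# else 0#

  combo : (Word n → KS) → (Word n → Carrier) → KS
  combo F c u = sumSn (λ w → c w * F w u)

  IsBasis : (Word n → KS) → Set (c ⊔ ℓ)
  IsBasis F =
    ((x : KS) → Σ (Word n → Carrier) λ cf → ∀ u → u ∈ Sn n → combo F cf u ≈ x u)
    × (∀ (cf cf' : Word n → Carrier) →
         (∀ u → u ∈ Sn n → combo F cf u ≈ combo F cf' u) →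
         ∀ w → w ∈ Sn n → cf w ≈ cf' w)

  lrmFamily : Word n → KS
  lrmFamily w = B (LRM' w) ⋆ δ w

{-# OPTIONS --safe #-}
-- Write < for the lexicographic order of one-line notations.  If Des(a) ⊆ LRM'(w), then a w < w
-- unless a = id.  Let i be the first position where a w and w differ, so that a fixes
-- w(1), …, w(i-1), and put m = w(i).  For x ≥ m, either x+1 is one of these fixed values, or it
-- stands to the right of the smaller value m in w; then x+1 ∉ LRM(w), so a ascends at x.  Hence
-- a(m) ≥ m would give a(x) ≥ x for all x ≥ m, and an injective inflationary map on {m, …, n} is
-- the identity; so a(m) < m.  Thus B_{LRM'(w)} w is w plus smaller permutations, and a family
-- that is unitriangular for an order which is well-founded in both directions is a basis.
module Submission where

open import Defs
open import Level using (Level; 0ℓ; _⊔_)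
open import Algebra.Bundles using (CommutativeRing)
import Algebra.Properties.CommutativeSemigroup as CommutativeSemigroupProperties
import Algebra.Properties.Ring as RingProperties
open import Data.Bool using (Bool; true; false; T; _∧_; _∨_; not; if_then_else_)
import Data.Bool.ListAction as ListAction
open import Data.Bool.Properties using (T-∧)
open import Data.Fin using (Fin; zero; suc; toℕ; fromℕ<; inject₁; punchOut; _≤_; _<_; _>_)
open import Data.Fin.Induction using (<-wellFounded; >-wellFounded)
import Data.Fin.Properties as Fin
open import Data.Fin.Properties
  using ( ≤-refl; ≤-reflexive; ≤-trans; ≤-total; ≤∧≢⇒<; <-cmp; <-irrefl; any?; injective⇒≤
        ; punchOut-injective; toℕ-injective; toℕ<n; toℕ-inject₁; toℕ-fromℕ<; fromℕ<-toℕ; ≤̄⇒inject₁<)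
open import Data.List as List
  using (List; []; _∷_; foldr; map; _++_; concatMap; cartesianProductWith)
open import Data.List.Membership.Propositional using (_∈_)
open import Data.List.Membership.Propositional.Properties
  using (∈-allFin; ∈-applyUpTo⁺; ∈-applyUpTo⁻; ∈-cartesianProductWith⁺; ∈-filter⁺; ∈-filter⁻)
open import Data.List.Relation.Unary.All as All using (All)
import Data.List.Relation.Unary.All.Properties as All
open import Data.List.Relation.Unary.Any using (here; there)
open import Data.List.Relation.Unary.Unique.Propositional using (Unique; []; _∷_)
import Data.List.Relation.Unary.Unique.Propositional.Properties as Unique
open import Data.Nat as ℕ using (ℕ; zero; suc; s≤s; _≡ᵇ_; _<ᵇ_; _≤ᵇ_; _∸_; _<?_)
import Data.Nat.Properties as ℕₚ
open import Data.Product using (Σ; ∃; _×_; _,_; proj₂)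
open import Data.Sum using (_⊎_; inj₁; inj₂)
open import Data.Unit using (tt)
open import Data.Vec using (Vec; []; _∷_; lookup; tabulate)
open import Data.Vec.Properties using (∷-injective; lookup∘tabulate; tabulate∘lookup; tabulate-cong)
open import Data.Vec.Relation.Binary.Lex.Strict as Lex using (Lex-<; base; this; next)
open import Data.Vec.Relation.Binary.Pointwise.Inductive using (Pointwise-≡⇒≡)
open import Function using (id; _∘_; flip; _⇔_; mk⇔; Equivalence)
open import Function.Definitions using (Injective)
open import Induction.WellFounded using (WellFounded; Acc; acc; module Subrelation)
open import Relation.Binary.Core using (Rel)
open import Relation.Binary.Definitions using (DecidableEquality; tri<; tri≈; tri>)
open import Relation.Binary.PropositionalEquality
  using (_≡_; _≢_; _≗_; refl; sym; trans; cong; subst; subst₂)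
open import Relation.Nullary using (¬_; yes; no; contradiction)
open import Relation.Nullary.Decidable using (⌊_⌋; T?)

-- Injective self-maps of Fin n

injective⇒surjective : ∀ {n} {f : Fin n → Fin n} → Injective _≡_ _≡_ f → ∀ y → ∃ λ x → f x ≡ y
injective⇒surjective {suc n} {f} f-injective y with any? (λ x → f x Fin.≟ y)
... | yes found = found
... | no  ¬found = contradiction (injective⇒≤ punchOut∘f-injective) ℕₚ.1+n≰n
  where
  punchOut∘f : Fin (suc n) → Fin n
  punchOut∘f x = punchOut {i = y} (λ y≡fx → ¬found (x , sym y≡fx))
  punchOut∘f-injective : Injective _≡_ _≡_ punchOut∘f
  punchOut∘f-injective = f-injective ∘ punchOut-injective {i = y} _ _

module _ {n : ℕ} {f : Fin n → Fin n} (f-injective : Injective _≡_ _≡_ f) where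

  inflationary⇒fixed : ∀ m → (∀ x → m ≤ x → x ≤ f x) → ∀ x → m ≤ x → f x ≡ x
  inflationary⇒fixed m inflationary x = go x (>-wellFounded x)
    where
    go : ∀ x → Acc _>_ x → m ≤ x → f x ≡ x
    go x (acc above) m≤x with f x Fin.≟ x
    ... | yes fx≡x = fx≡x
    ... | no  fx≢x = f-injective (go (f x) (above x<fx) (≤-trans m≤x x≤fx))
      where
      x≤fx : x ≤ f x
      x≤fx = inflationary x m≤x
      x<fx : x < f x
      x<fx = ≤∧≢⇒< x≤fx (fx≢x ∘ sym)

ascending⇒inflationary : ∀ {n} {f : Fin n → Fin n} m → m ≤ f m →
  (∀ x y → toℕ y ≡ suc (toℕ x) → m ≤ x → f y ≡ y ⊎ f x < f y) →
  ∀ y → m ≤ y → y ≤ f y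
ascending⇒inflationary {f = f} m m≤fm ascending y = go y (<-wellFounded y)
  where
  go : ∀ y → Acc _<_ y → m ≤ y → y ≤ f y
  go y _ m≤y with m Fin.≟ y
  go y       _           _   | yes refl = m≤fm
  go zero    _           m≤0 | no m≢0   = contradiction (≤∧≢⇒< m≤0 m≢0) λ ()
  go (suc j) (acc below) m≤y | no m≢y   = step (ascending x (suc j) y≡1+x m≤x)
    where
    x : Fin _
    x = inject₁ j
    y≡1+x : toℕ (suc j) ≡ suc (toℕ x)
    y≡1+x = cong suc (sym (toℕ-inject₁ j))
    m≤x : m ≤ x
    m≤x = subst (toℕ m ℕ.≤_) (sym (toℕ-inject₁ j)) (ℕ.s≤s⁻¹ (≤∧≢⇒< m≤y m≢y))
    step : f (suc j) ≡ suc j ⊎ f x < f (suc j) → suc j ≤ f (suc j)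
    step (inj₁ fy≡y)  = ≤-reflexive (sym fy≡y)
    step (inj₂ fx<fy) = subst (ℕ._≤ toℕ (f (suc j))) (sym y≡1+x) (ℕₚ.≤-<-trans x≤fx fx<fy)
      where
      x≤fx : x ≤ f x
      x≤fx = go x (below (≤̄⇒inject₁< ≤-refl)) m≤x

-- The hypothesis ascent says: a ascends at x whenever x+1 is not a left-to-right minimum of w.
module _ {n : ℕ} {a w : Fin n → Fin n}
  (a-injective : Injective _≡_ _≡_ a) (w-surjective : ∀ y → ∃ λ k → w k ≡ y)
  (ascent : ∀ x y q k → toℕ y ≡ suc (toℕ x) → q < k → w k ≡ y → w q < y → a x < a y)
  where

  fixesPrefix⇒≤ : ∀ i → (∀ j → j < i → a (w j) ≡ w j) → a (w i) ≤ w i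
  fixesPrefix⇒≤ i fixesPrefix with ≤-total (a (w i)) (w i)
  ... | inj₁ a[m]≤m = a[m]≤m
  ... | inj₂ m≤a[m] = ≤-reflexive (inflationary⇒fixed a-injective (w i) inflationary (w i) ≤-refl)
    where
    below-successor : ∀ {x y} → toℕ y ≡ suc (toℕ x) → w i ≤ x → w i < y
    below-successor y≡1+x m≤x = subst (toℕ (w i) ℕ.<_) (sym y≡1+x) (s≤s m≤x)
    ascending : ∀ x y → toℕ y ≡ suc (toℕ x) → w i ≤ x → a y ≡ y ⊎ a x < a y
    ascending x y y≡1+x m≤x with w-surjective y
    ... | k , wk≡y with <-cmp k i
    ...   | tri< k<i _ _  = inj₁ (subst (λ z → a z ≡ z) wk≡y (fixesPrefix k k<i))
    ...   | tri≈ _ refl _ = contradiction (below-successor y≡1+x m≤x) (<-irrefl wk≡y)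
    ...   | tri> _ _ i<k  = inj₂ (ascent x y i k y≡1+x i<k wk≡y (below-successor y≡1+x m≤x))
    inflationary : ∀ x → w i ≤ x → x ≤ a x
    inflationary = ascending⇒inflationary (w i) m≤a[m] ascending

-- Strict lexicographic order on vectors

Lex-<⇒firstDifference : ∀ {a ℓ} {A : Set a} {_≺_ : Rel A ℓ} {n} {xs ys : Vec A n} →
  Lex-< _≡_ _≺_ xs ys →
  ∃ λ i → (∀ j → j < i → lookup xs j ≡ lookup ys j) × lookup xs i ≺ lookup ys i
Lex-<⇒firstDifference (base ())
Lex-<⇒firstDifference (this x≺y _) = zero , (λ _ ()) , x≺y
Lex-<⇒firstDifference {xs = x ∷ xs} {_ ∷ ys} (next refl xs<ys) with Lex-<⇒firstDifference xs<ys
... | i , agree , differ = suc i , agree′ , differ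
  where
  agree′ : ∀ j → j < suc i → lookup (x ∷ xs) j ≡ lookup (x ∷ ys) j
  agree′ zero    _     = refl
  agree′ (suc j) j<1+i = agree j (ℕ.s≤s⁻¹ j<1+i)

Lex-<-flip : ∀ {a ℓ} {A : Set a} {_≺_ : Rel A ℓ} {m n} {xs : Vec A m} {ys : Vec A n} →
  Lex-< _≡_ _≺_ xs ys → Lex-< _≡_ (flip _≺_) ys xs
Lex-<-flip (base ())
Lex-<-flip (this x≺y m≡n)   = this x≺y (sym m≡n)
Lex-<-flip (next x≡y xs<ys) = next (sym x≡y) (Lex-<-flip xs<ys)

_<ˡᵉˣ_ : ∀ {n} → Rel (Word n) 0ℓ
_<ˡᵉˣ_ = Lex-< _≡_ _<_

<ˡᵉˣ-wellFounded : ∀ {n} → WellFounded (_<ˡᵉˣ_ {n})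
<ˡᵉˣ-wellFounded = Lex.<-wellFounded trans Fin.<-respʳ-≡ <-wellFounded

>ˡᵉˣ-wellFounded : ∀ {n} → WellFounded (flip (_<ˡᵉˣ_ {n}))
>ˡᵉˣ-wellFounded =
  Subrelation.wellFounded Lex-<-flip (Lex.<-wellFounded trans Fin.<-respˡ-≡ >-wellFounded)

-- Reading the Boolean definitions

all≗ListAction-all : ∀ {A : Set} (p : A → Bool) → all p ≗ ListAction.all p
all≗ListAction-all p []       = refl
all≗ListAction-all p (x ∷ xs) = cong (p x ∧_) (all≗ListAction-all p xs)

all⇔All : ∀ {A : Set} (p : A → Bool) xs → T (all p xs) ⇔ All (T ∘ p) xs
all⇔All p xs = mk⇔ (All.all⁺ p xs ∘ subst T (all≗ListAction-all p xs))
                   (subst T (sym (all≗ListAction-all p xs)) ∘ All.all⁻ p)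

T-∨-not : ∀ {b c} → T (b ∨ not c) ⇔ (T c → T b)
T-∨-not {true}          = mk⇔ (λ _ _ → tt) (λ _ → tt)
T-∨-not {false} {false} = mk⇔ (λ _ ()) (λ _ → tt)
T-∨-not {false} {true}  = mk⇔ (λ ()) (λ h → h tt)

T-not-∨ : ∀ {c b} → T (not c ∨ b) ⇔ (T c → T b)
T-not-∨ {false}         = mk⇔ (λ _ ()) (λ _ → tt)
T-not-∨ {true} {true}   = mk⇔ (λ _ _ → tt) (λ _ → tt)
T-not-∨ {true} {false}  = mk⇔ (λ ()) (λ h → h tt)

IsPermutation : ∀ {n} → Word n → Set
IsPermutation w = Injective _≡_ _≡_ (lookup w)

isPerm⇔IsPermutation : ∀ {n} (v : Word n) → T (isPerm v) ⇔ IsPermutation v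
isPerm⇔IsPermutation {n} v = mk⇔ to from
  where
  ≡ᵇ⇔≡ : ∀ {i j : Fin n} → T (toℕ i ≡ᵇ toℕ j) ⇔ i ≡ j
  ≡ᵇ⇔≡ = mk⇔ (toℕ-injective ∘ ℕₚ.≡ᵇ⇒≡ _ _) (ℕₚ.≡⇒≡ᵇ _ _ ∘ cong toℕ)
  entry : Fin n → Fin n → Bool
  entry i j = (toℕ i ≡ᵇ toℕ j) ∨ not (toℕ (lookup v i) ≡ᵇ toℕ (lookup v j))
  row : ∀ i → T (all (entry i) (List.allFin n)) ⇔ All (T ∘ entry i) (List.allFin n)
  row i = all⇔All (entry i) (List.allFin n)
  rows : T (isPerm v) ⇔ All (λ i → T (all (entry i) (List.allFin n))) (List.allFin n)
  rows = all⇔All (λ i → all (entry i) (List.allFin n)) (List.allFin n)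
  entries : T (isPerm v) ⇔ (∀ i j → T (entry i j))
  entries = mk⇔
    (λ perm i j → All.lookup (Equivalence.to (row i)
                    (All.lookup (Equivalence.to rows perm) (∈-allFin i))) (∈-allFin j))
    (λ entry-holds → Equivalence.from rows (All.tabulate λ {i} _ →
                       Equivalence.from (row i) (All.tabulate λ {j} _ → entry-holds i j)))
  to : T (isPerm v) → IsPermutation v
  to perm {i} {j} = Equivalence.to ≡ᵇ⇔≡ ∘ Equivalence.to T-∨-not (Equivalence.to entries perm i j)
                  ∘ Equivalence.from ≡ᵇ⇔≡
  from : IsPermutation v → T (isPerm v)
  from injective = Equivalence.from entries λ i j → Equivalence.from (T-∨-not {toℕ i ≡ᵇ toℕ j})
    (Equivalence.from ≡ᵇ⇔≡ ∘ injective ∘ Equivalence.to ≡ᵇ⇔≡)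

concatMap≡cartesianProductWith : ∀ {A B C : Set} (f : A → B → C) xs ys →
  concatMap (λ x → map (f x) ys) xs ≡ cartesianProductWith f xs ys
concatMap≡cartesianProductWith f []       ys = refl
concatMap≡cartesianProductWith f (x ∷ xs) ys =
  cong (map (f x) ys ++_) (concatMap≡cartesianProductWith f xs ys)

allVec-suc : ∀ {n} m → allVec {n} (suc m) ≡ cartesianProductWith _∷_ (List.allFin n) (allVec m)
allVec-suc {n} m = concatMap≡cartesianProductWith _∷_ (List.allFin n) (allVec m)

allVec-complete : ∀ {n m} (v : Vec (Fin n) m) → v ∈ allVec m
allVec-complete []      = here refl
allVec-complete (x ∷ v) = subst (x ∷ v ∈_) (sym (allVec-suc _))
  (∈-cartesianProductWith⁺ _∷_ (∈-allFin x) (allVec-complete v))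

allVec-unique : ∀ {n} m → Unique (allVec {n} m)
allVec-unique zero        = All.[] ∷ []
allVec-unique {n} (suc m) = subst Unique (sym (allVec-suc m))
  (Unique.cartesianProductWith⁺ _∷_ ∷-injective (Unique.allFin⁺ n) (allVec-unique m))

Sn-unique : ∀ n → Unique (Sn n)
Sn-unique n = Unique.filter⁺ (T? ∘ isPerm) (allVec-unique n)

∈Sn⇔IsPermutation : ∀ {n} {w : Word n} → w ∈ Sn n ⇔ IsPermutation w
∈Sn⇔IsPermutation {n} {w} = mk⇔
  (Equivalence.to (isPerm⇔IsPermutation w) ∘ proj₂ ∘ ∈-filter⁻ (T? ∘ isPerm) {xs = allVec n})
  (∈-filter⁺ (T? ∘ isPerm) (allVec-complete w) ∘ Equivalence.from (isPerm⇔IsPermutation w))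

-- Defs counts positions and values from 1, Fin from 0: position x : Fin n is suc (toℕ x).

ev-suc : ∀ {n} (w : Word n) {j} (j<n : j ℕ.< n) → ev w (suc j) ≡ suc (toℕ (lookup w (fromℕ< j<n)))
ev-suc {n} w {j} j<n with j <? n
... | yes _   = refl
... | no  j≮n = contradiction j<n j≮n

ev-lookup : ∀ {n} (w : Word n) i → ev w (suc (toℕ i)) ≡ suc (toℕ (lookup w i))
ev-lookup w i = trans (ev-suc w (toℕ<n i)) (cong (suc ∘ toℕ ∘ lookup w) (fromℕ<-toℕ i (toℕ<n i)))

∈oneTo⇒position : ∀ {n k} → k ∈ oneTo n → ∃ λ (x : Fin n) → k ≡ suc (toℕ x)
∈oneTo⇒position k∈ with ∈-applyUpTo⁻ suc k∈
... | j , j<n , refl = fromℕ< j<n , cong suc (sym (toℕ-fromℕ< j<n))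

firstWhere : (ℕ → Bool) → List ℕ → ℕ
firstWhere p []       = 0
firstWhere p (k ∷ ks) = if p k then k else firstWhere p ks

search≗firstWhere : ∀ (p : ℕ → Bool) {search : List ℕ → ℕ} → search [] ≡ 0 →
  (∀ k ks → search (k ∷ ks) ≡ (if p k then k else search ks)) → ∀ ks → search ks ≡ firstWhere p ks
search≗firstWhere p nil cons []       = nil
search≗firstWhere p nil cons (k ∷ ks) =
  trans (cons k ks) (cong (if p k then k else_) (search≗firstWhere p nil cons ks))

firstWhere-unique : ∀ {p t ks} → t ∈ ks → T (p t) → (∀ {k} → k ∈ ks → T (p k) → k ≡ t) →
  firstWhere p ks ≡ t
firstWhere-unique {p} {t} {k ∷ ks} t∈ks pt unique with p k in pk
... | true  = unique (here refl) (subst T (sym pk) tt)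
... | false with t∈ks
...   | here refl   = contradiction (subst T pk pt) λ ()
...   | there t∈ks′ = firstWhere-unique t∈ks′ pt (unique ∘ there)

-- posOf searches with a local function that cannot be named; once its list argument is
-- abstracted by with, unification instantiates search with that function.
posOf≡firstWhere : ∀ {n} (w : Word n) v → posOf w v ≡ firstWhere (λ k → ev w k ≡ᵇ v) (oneTo n)
posOf≡firstWhere {n} w v with oneTo n | search≗firstWhere (λ k → ev w k ≡ᵇ v) {search = _}
... | ks | agree = agree refl (λ _ _ → refl) ks

posOf-lookup : ∀ {n} {w : Word n} → IsPermutation w → ∀ i →
  posOf w (suc (toℕ (lookup w i))) ≡ suc (toℕ i)
posOf-lookup {n} {w} w-perm i =
  trans (posOf≡firstWhere w _) (firstWhere-unique (∈-applyUpTo⁺ suc (toℕ<n i)) found unique)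
  where
  found : T (ev w (suc (toℕ i)) ≡ᵇ suc (toℕ (lookup w i)))
  found = ℕₚ.≡⇒≡ᵇ _ _ (ev-lookup w i)
  unique : ∀ {k} → k ∈ oneTo n → T (ev w k ≡ᵇ suc (toℕ (lookup w i))) → k ≡ suc (toℕ i)
  unique k∈ hit with ∈oneTo⇒position k∈
  ... | x , refl = cong (suc ∘ toℕ) (w-perm (toℕ-injective (ℕₚ.suc-injective
                     (trans (sym (ev-lookup w x)) (ℕₚ.≡ᵇ⇒≡ _ _ hit)))))

DesSub⇒descent∈ : ∀ {n} {a : Word n} {I : ℕ → Bool} {x y : Fin n} → T (DesSub a I) →
  toℕ y ≡ suc (toℕ x) → lookup a y < lookup a x → T (I (suc (toℕ x)))
DesSub⇒descent∈ {suc n} {a} {I} {x} {y} desSub y≡1+x ay<ax =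
  Equivalence.to T-not-∨ (All.lookup allowed (∈-applyUpTo⁺ suc x<n)) descent
  where
  allowed : All (λ i → T (not (Des a i) ∨ I i)) (oneTo n)
  allowed = Equivalence.to (all⇔All (λ i → not (Des a i) ∨ I i) (oneTo n)) desSub
  x<n : toℕ x ℕ.< n
  x<n = ℕ.s≤s⁻¹ (subst (ℕ._< suc n) y≡1+x (toℕ<n y))
  drop : T (ev a (suc (suc (toℕ x))) <ᵇ ev a (suc (toℕ x)))
  drop = subst (λ z → T (ev a (suc z) <ᵇ ev a (suc (toℕ x)))) y≡1+x
           (subst₂ (λ u v → T (u <ᵇ v)) (sym (ev-lookup a y)) (sym (ev-lookup a x)) (ℕₚ.<⇒<ᵇ ay<ax))
  descent : T (Des a (suc (toℕ x)))
  descent = Equivalence.from T-∧ (ℕₚ.≤⇒≤ᵇ x<n , drop)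

smallerEarlier⇒¬LRM : ∀ {n} {w : Word n} → IsPermutation w → ∀ {q k} → q < k →
  lookup w q < lookup w k → ¬ T (LRM w (suc (toℕ (lookup w k))))
smallerEarlier⇒¬LRM {n} {w} w-perm {q} {k} q<k wq<wk lrm = ℕₚ.<-asym wq<wk wk<wq
  where
  y : ℕ
  y = suc (toℕ (lookup w k))
  earlier-larger : All (λ p → T (y <ᵇ ev w p)) (oneTo (posOf w y ∸ 1))
  earlier-larger = Equivalence.to (all⇔All _ _) (proj₂ (Equivalence.to (T-∧ {y ≤ᵇ n}) lrm))
  wk<wq : toℕ (lookup w k) ℕ.< toℕ (lookup w q)
  wk<wq = ℕₚ.<ᵇ⇒< _ _ (subst (λ z → T (y <ᵇ z)) (ev-lookup w q)
            (All.lookup (subst (λ p → All (λ z → T (y <ᵇ ev w z)) (oneTo (p ∸ 1)))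
                               (posOf-lookup w-perm k) earlier-larger)
                        (∈-applyUpTo⁺ suc q<k)))

DesSub-LRM'⇒ascent : ∀ {n} {a w : Word n} → IsPermutation a → IsPermutation w →
  T (DesSub a (LRM' w)) →
  ∀ x y q k → toℕ y ≡ suc (toℕ x) → q < k → lookup w k ≡ y → lookup w q < y →
  lookup a x < lookup a y
DesSub-LRM'⇒ascent {a = a} {w} a-perm w-perm desSub x y q k y≡1+x q<k wk≡y wq<y =
  ≤∧≢⇒< (ℕₚ.≮⇒≥ no-descent) λ ax≡ay →
    ℕₚ.1+n≢n (trans (sym y≡1+x) (cong toℕ (sym (a-perm ax≡ay))))
  where
  no-descent : ¬ lookup a y < lookup a x
  no-descent ay<ax = smallerEarlier⇒¬LRM w-perm q<k (subst (lookup w q <_) (sym wk≡y) wq<y)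
    (subst (λ z → T (LRM w (suc z))) (trans (sym y≡1+x) (cong toℕ (sym wk≡y)))
           (DesSub⇒descent∈ desSub y≡1+x ay<ax))

identity : ∀ {n} → Word n
identity = tabulate id

lookup-identity : ∀ {n} (i : Fin n) → lookup identity i ≡ i
lookup-identity = lookup∘tabulate id

identity-isPermutation : ∀ {n} → IsPermutation (identity {n})
identity-isPermutation {x = i} {j} eq = trans (sym (lookup-identity i)) (trans eq (lookup-identity j))

lookup-compose : ∀ {n} (u w : Word n) i → lookup (compose u w) i ≡ lookup u (lookup w i)
lookup-compose u w = lookup∘tabulate (lookup u ∘ lookup w)

compose-identityˡ : ∀ {n} (w : Word n) → compose identity w ≡ w
compose-identityˡ w = trans (tabulate-cong (lookup-identity ∘ lookup w)) (tabulate∘lookup w)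

compose-fixed⇒identity : ∀ {n} {a w : Word n} → IsPermutation w → compose a w ≡ w → a ≡ identity
compose-fixed⇒identity {a = a} {w} w-perm aw≡w = trans (sym (tabulate∘lookup a)) (tabulate-cong fixed)
  where
  fixed : ∀ y → lookup a y ≡ y
  fixed y with injective⇒surjective w-perm y
  ... | k , refl = trans (sym (lookup-compose a w k)) (cong (λ v → lookup v k) aw≡w)

DesSub-identity : ∀ {n} (I : ℕ → Bool) → T (DesSub (identity {n}) I)
DesSub-identity {zero}  I = tt
DesSub-identity {suc n} I =
  Equivalence.from (all⇔All (λ i → not (Des (identity {suc n}) i) ∨ I i) (oneTo n))
                   (All.tabulate no-descent)
  where
  ev-identity : ∀ {j} (j<n : j ℕ.< suc n) → ev (identity {suc n}) (suc j) ≡ suc j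
  ev-identity j<n = trans (ev-suc (identity {suc n}) j<n)
                          (cong suc (trans (cong toℕ (lookup-identity _)) (toℕ-fromℕ< j<n)))
  no-descent : ∀ {i} → i ∈ oneTo n → T (not (Des (identity {suc n}) i) ∨ I i)
  no-descent i∈ with ∈oneTo⇒position i∈
  ... | x , refl = Equivalence.from T-not-∨ λ des → contradiction (drop des) (ℕₚ.<-asym (ℕₚ.n<1+n _))
    where
    drop : T (Des (identity {suc n}) (suc (toℕ x))) → suc (toℕ x) ℕ.< toℕ x
    drop des = ℕₚ.<ᵇ⇒< _ _ (subst₂ (λ u v → T (u <ᵇ v))
                 (ev-identity (s≤s (toℕ<n x))) (ev-identity (ℕₚ.m<n⇒m<1+n (toℕ<n x)))
                 (proj₂ (Equivalence.to (T-∧ {suc (toℕ x) ≤ᵇ n}) des)))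

compose-triangular : ∀ {n} {a w : Word n} → IsPermutation a → IsPermutation w →
  T (DesSub a (LRM' w)) → compose a w ≡ w ⊎ compose a w <ˡᵉˣ w
compose-triangular {a = a} {w} a-perm w-perm desSub with Lex.<-cmp sym <-cmp (compose a w) w
... | tri< aw<w _ _ = inj₂ aw<w
... | tri≈ _ aw≋w _ = inj₁ (Pointwise-≡⇒≡ aw≋w)
... | tri> _ _ w<aw with Lex-<⇒firstDifference w<aw
...   | i , agree , differ = contradiction
          (fixesPrefix⇒≤ a-perm (injective⇒surjective w-perm) (DesSub-LRM'⇒ascent a-perm w-perm desSub)
                         i fixed)
          (ℕₚ.<⇒≱ (subst (lookup w i <_) (lookup-compose a w i) differ))
  where
  fixed : ∀ j → j < i → lookup a (lookup w j) ≡ lookup w j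
  fixed j j<i = sym (trans (agree j j<i) (lookup-compose a w j))

-- Unitriangular families are bases

-- For L = Sn n and _≟_ = _≟W_, sumOver L, δ and combination are definitionally sumSn,
-- GroupAlgebra.δ and combo.
module LinearAlgebra {c ℓ} (R : CommutativeRing c ℓ) {I : Set} (_≟_ : DecidableEquality I) where

  open CommutativeRing R renaming (refl to ≈-refl; sym to ≈-sym; trans to ≈-trans)
  open RingProperties ring using (-1*x≈-x; +-cancelʳ)
  open CommutativeSemigroupProperties +-commutativeSemigroup
    using () renaming (interchange to +-interchange; x∙yz≈y∙xz to x+[y+z]≈y+[x+z])
  open import Relation.Binary.Reasoning.Setoid setoid

  sumOver : List I → (I → Carrier) → Carrier
  sumOver xs f = foldr (λ x acc → f x + acc) 0# xs

  δ : I → I → Carrier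
  δ w u = if ⌊ u ≟ w ⌋ then 1# else 0#

  δ-diagonal : ∀ u → δ u u ≈ 1#
  δ-diagonal u with u ≟ u
  ... | yes _   = ≈-refl
  ... | no  u≢u = contradiction refl u≢u

  δ-offDiagonal : ∀ {u v} → v ≢ u → δ u v ≈ 0#
  δ-offDiagonal {u} {v} v≢u with v ≟ u
  ... | yes v≡u = contradiction v≡u v≢u
  ... | no  _   = ≈-refl

  _without_ : (I → Carrier) → I → I → Carrier
  (f without u) v = if ⌊ v ≟ u ⌋ then 0# else f v

  without-other : ∀ f {u v} → v ≢ u → (f without u) v ≈ f v
  without-other f {u} {v} v≢u with v ≟ u
  ... | yes v≡u = contradiction v≡u v≢u
  ... | no  _   = ≈-refl

  sumOver-cong : ∀ xs {f g} → (∀ {x} → x ∈ xs → f x ≈ g x) → sumOver xs f ≈ sumOver xs g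
  sumOver-cong []       f≈g = ≈-refl
  sumOver-cong (x ∷ xs) f≈g = +-cong (f≈g (here refl)) (sumOver-cong xs (f≈g ∘ there))

  sumOver-zero : ∀ xs {f} → (∀ {x} → x ∈ xs → f x ≈ 0#) → sumOver xs f ≈ 0#
  sumOver-zero []       f≈0 = ≈-refl
  sumOver-zero (x ∷ xs) f≈0 =
    ≈-trans (+-cong (f≈0 (here refl)) (sumOver-zero xs (f≈0 ∘ there))) (+-identityʳ 0#)

  sumOver-+ : ∀ xs {f g} → sumOver xs (λ x → f x + g x) ≈ sumOver xs f + sumOver xs g
  sumOver-+ []               = ≈-sym (+-identityʳ 0#)
  sumOver-+ (x ∷ xs) {f} {g} = ≈-trans (+-congˡ (sumOver-+ xs)) (+-interchange (f x) (g x) _ _)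

  sumOver-*ˡ : ∀ xs a {f} → sumOver xs (λ x → a * f x) ≈ a * sumOver xs f
  sumOver-*ˡ []       a     = ≈-sym (zeroʳ a)
  sumOver-*ˡ (x ∷ xs) a {f} = ≈-trans (+-congˡ (sumOver-*ˡ xs a)) (≈-sym (distribˡ a (f x) _))

  sumOver-split : ∀ {xs} f {u} → Unique xs → u ∈ xs → sumOver xs f ≈ f u + sumOver xs (f without u)
  sumOver-split {x ∷ xs} f {u} (x∉xs ∷ xs-unique) u∈ with x ≟ u | u∈
  ... | yes refl | _          = +-congˡ (≈-trans (sumOver-cong xs unchanged) (≈-sym (+-identityˡ _)))
    where
    unchanged : ∀ {v} → v ∈ xs → f v ≈ (f without x) v
    unchanged v∈ = ≈-sym (without-other f λ { refl → All.lookup x∉xs v∈ refl })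
  ... | no x≢u   | here u≡x   = contradiction (sym u≡x) x≢u
  ... | no x≢u   | there u∈xs =
    ≈-trans (+-congˡ (sumOver-split f xs-unique u∈xs)) (x+[y+z]≈y+[x+z] (f x) (f u) _)

  sumOver-single : ∀ {xs} f {u} → Unique xs → u ∈ xs → (∀ {v} → v ∈ xs → v ≢ u → f v ≈ 0#) →
    sumOver xs f ≈ f u
  sumOver-single {xs} f {u} unique u∈ others≈0 = begin
    sumOver xs f                      ≈⟨ sumOver-split f unique u∈ ⟩
    f u + sumOver xs (f without u)    ≈⟨ +-congˡ (sumOver-zero xs rest≈0) ⟩
    f u + 0#                          ≈⟨ +-identityʳ (f u) ⟩
    f u                               ∎
    where
    rest≈0 : ∀ {v} → v ∈ xs → (f without u) v ≈ 0#
    rest≈0 {v} v∈ with v ≟ u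
    ... | yes _   = ≈-refl
    ... | no  v≢u = others≈0 v∈ v≢u

  module _ (L : List I) (L-unique : Unique L) (F : I → I → Carrier) where

    combination : (I → Carrier) → I → Carrier
    combination coeff u = sumOver L (λ w → coeff w * F w u)

    Spans : (I → Carrier) → Set (c ⊔ ℓ)
    Spans x = Σ (I → Carrier) λ coeff → ∀ u → u ∈ L → combination coeff u ≈ x u

    span-cong : ∀ {x y} → Spans x → (∀ u → u ∈ L → x u ≈ y u) → Spans y
    span-cong (coeff , spans) x≈y = coeff , λ u u∈ → ≈-trans (spans u u∈) (x≈y u u∈)

    span-0 : Spans (λ _ → 0#)
    span-0 = (λ _ → 0#) , λ u _ → sumOver-zero L λ {w} _ → zeroˡ (F w u)

    span-+ : ∀ {x y} → Spans x → Spans y → Spans (λ u → x u + y u)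
    span-+ {x} {y} (a , spans-x) (b , spans-y) = (λ w → a w + b w) , λ u u∈ → begin
      sumOver L (λ w → (a w + b w) * F w u)
        ≈⟨ sumOver-cong L (λ {w} _ → distribʳ (F w u) (a w) (b w)) ⟩
      sumOver L (λ w → a w * F w u + b w * F w u)
        ≈⟨ sumOver-+ L ⟩
      combination a u + combination b u
        ≈⟨ +-cong (spans-x u u∈) (spans-y u u∈) ⟩
      x u + y u ∎

    span-* : ∀ {x} r → Spans x → Spans (λ u → r * x u)
    span-* {x} r (a , spans-x) = (λ w → r * a w) , λ u u∈ → begin
      sumOver L (λ w → (r * a w) * F w u)   ≈⟨ sumOver-cong L (λ {w} _ → *-assoc r (a w) (F w u)) ⟩
      sumOver L (λ w → r * (a w * F w u))   ≈⟨ sumOver-*ˡ L r ⟩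
      r * combination a u                   ≈⟨ *-congˡ (spans-x u u∈) ⟩
      r * x u                               ∎

    span-sumOver : ∀ xs {g : I → I → Carrier} → (∀ {v} → v ∈ xs → Spans (g v)) →
      Spans (λ u → sumOver xs (λ v → g v u))
    span-sumOver []       spans = span-0
    span-sumOver (v ∷ xs) spans = span-+ (spans (here refl)) (span-sumOver xs (spans ∘ there))

    span-member : ∀ {u} → u ∈ L → Spans (F u)
    span-member {u} u∈ = δ u , λ y _ → ≈-trans
      (sumOver-single (λ w → δ u w * F w y) L-unique u∈ λ {w} _ w≢u →
         ≈-trans (*-congʳ (δ-offDiagonal w≢u)) (zeroˡ (F w y)))
      (≈-trans (*-congʳ (δ-diagonal u)) (*-identityˡ (F u y)))

    δ-expansion : ∀ (x : I → Carrier) {y} → y ∈ L → sumOver L (λ u → x u * δ u y) ≈ x y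
    δ-expansion x {y} y∈ = ≈-trans
      (sumOver-single (λ u → x u * δ u y) L-unique y∈ λ {u} _ u≢y →
         ≈-trans (*-congˡ (δ-offDiagonal (u≢y ∘ sym))) (zeroʳ (x u)))
      (≈-trans (*-congˡ (δ-diagonal y)) (*-identityʳ (x y)))

    -- Spanning recurses down ≺ and independence up ≺, hence two well-foundedness assumptions.
    module Unitriangular {ℓ′} {_≺_ : Rel I ℓ′}
      (diagonal : ∀ {w} → w ∈ L → F w w ≈ 1#)
      (triangular : ∀ {v w} → v ∈ L → w ∈ L → v ≢ w → F v w ≈ 0# ⊎ w ≺ v)
      where

      span-δ : WellFounded _≺_ → ∀ {u} → u ∈ L → Spans (δ u)
      span-δ ≺-wf {u} = go u (≺-wf u)
        where
        go : ∀ u → Acc _≺_ u → u ∈ L → Spans (δ u)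
        go u (acc below) u∈ =
          span-cong (span-+ (span-member u∈) (span-* (- 1#) (span-sumOver L lower))) δ≈
          where
          G : I → I → Carrier
          G v y = ((λ v → F u v * δ v y) without u) v
          lower : ∀ {v} → v ∈ L → Spans (G v)
          lower {v} v∈ with v ≟ u
          ... | yes _   = span-0
          ... | no  v≢u with triangular u∈ v∈ (v≢u ∘ sym)
          ...   | inj₁ Fuv≈0 = span-cong span-0 λ y _ → ≈-sym (≈-trans (*-congʳ Fuv≈0) (zeroˡ (δ v y)))
          ...   | inj₂ v≺u   = span-* (F u v) (go v (below v≺u) v∈)
          δ≈ : ∀ y → y ∈ L → F u y + - 1# * sumOver L (λ v → G v y) ≈ δ u y
          δ≈ y y∈ = begin
            F u y + - 1# * sumOver L (λ v → G v y)
              ≈⟨ +-cong (≈-trans (≈-sym (δ-expansion (F u) y∈)) (sumOver-split _ L-unique u∈))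
                        (-1*x≈-x _) ⟩
            (F u u * δ u y + sumOver L (λ v → G v y)) + - sumOver L (λ v → G v y)
              ≈⟨ +-assoc _ _ _ ⟩
            F u u * δ u y + (sumOver L (λ v → G v y) + - sumOver L (λ v → G v y))
              ≈⟨ +-cong (*-congʳ (diagonal u∈)) (-‿inverseʳ _) ⟩
            1# * δ u y + 0#
              ≈⟨ ≈-trans (+-identityʳ _) (*-identityˡ _) ⟩
            δ u y ∎

      spanning : WellFounded _≺_ → (x : I → Carrier) → Spans x
      spanning ≺-wf x = span-cong
        (span-sumOver L λ {u} u∈ → span-* (x u) (span-δ ≺-wf u∈))
        λ y y∈ → δ-expansion x y∈

      independent : WellFounded (flip _≺_) →
        ∀ a b → (∀ u → u ∈ L → combination a u ≈ combination b u) → ∀ w → w ∈ L → a w ≈ b w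
      independent ≻-wf a b same w = go w (≻-wf w)
        where
        go : ∀ w → Acc (flip _≺_) w → w ∈ L → a w ≈ b w
        go w (acc above) w∈ = +-cancelʳ (rest a) (a w) (b w) (begin
          a w + rest a                ≈⟨ +-congʳ (≈-sym (coefficient a)) ⟩
          a w * F w w + rest a        ≈⟨ ≈-sym (sumOver-split _ L-unique w∈) ⟩
          combination a w             ≈⟨ same w w∈ ⟩
          combination b w             ≈⟨ sumOver-split _ L-unique w∈ ⟩
          b w * F w w + rest b        ≈⟨ +-cong (coefficient b) (sumOver-cong L (≈-sym ∘ rest≈)) ⟩
          b w + rest a                ∎)
          where
          term : (I → Carrier) → I → Carrier
          term d = (λ v → d v * F v w) without w
          rest : (I → Carrier) → Carrier
          rest d = sumOver L (term d)
          coefficient : ∀ d → d w * F w w ≈ d w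
          coefficient d = ≈-trans (*-congˡ (diagonal w∈)) (*-identityʳ (d w))
          rest≈ : ∀ {v} → v ∈ L → term a v ≈ term b v
          rest≈ {v} v∈ with v ≟ w
          ... | yes _   = ≈-refl
          ... | no  v≢w with triangular v∈ w∈ v≢w
          ...   | inj₁ Fvw≈0 = ≈-trans (vanishes a) (≈-sym (vanishes b))
            where
            vanishes : ∀ d → d v * F v w ≈ 0#
            vanishes d = ≈-trans (*-congˡ Fvw≈0) (zeroʳ (d v))
          ...   | inj₂ w≺v   = *-congʳ (go v (above w≺v) v∈)

      isBasis : WellFounded _≺_ → WellFounded (flip _≺_) →
        ((x : I → Carrier) → Spans x) ×
        (∀ a b → (∀ u → u ∈ L → combination a u ≈ combination b u) → ∀ w → w ∈ L → a w ≈ b w)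
      isBasis ≺-wf ≻-wf = spanning ≺-wf , independent ≻-wf

-- The family B_{LRM'(w)} w

module _ {c ℓ} (R : CommutativeRing c ℓ) (n : ℕ) where

  open CommutativeRing R renaming (refl to ≈-refl; sym to ≈-sym; trans to ≈-trans)
  open GroupAlgebra R n using (_⋆_; δ; B; lrmFamily)
  open LinearAlgebra R (_≟W_ {n}) hiding (δ)

  DesSub⇒B≈1 : ∀ {I u} → T (DesSub u I) → B I u ≈ 1#
  DesSub⇒B≈1 {I} {u} des with DesSub u I
  ... | true = ≈-refl

  ¬DesSub⇒B≈0 : ∀ {I u} → ¬ T (DesSub u I) → B I u ≈ 0#
  ¬DesSub⇒B≈0 {I} {u} ¬des with DesSub u I
  ... | true  = contradiction _ ¬des
  ... | false = ≈-refl

  ⋆-δʳ : ∀ f {v} → v ∈ Sn n → ∀ w →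
    (f ⋆ δ v) w ≈ sumOver (Sn n) (λ a → if ⌊ compose a v ≟W w ⌋ then f a else 0#)
  ⋆-δʳ f {v} v∈ w = sumOver-cong (Sn n) λ {a} _ →
    ≈-trans (sumOver-single _ (Sn-unique n) v∈ (off-v a)) (at-v a)
    where
    off-v : ∀ a {b} → b ∈ Sn n → b ≢ v → (if ⌊ compose a b ≟W w ⌋ then f a * δ v b else 0#) ≈ 0#
    off-v a {b} _ b≢v with compose a b ≟W w
    ... | yes _ = ≈-trans (*-congˡ (δ-offDiagonal b≢v)) (zeroʳ (f a))
    ... | no  _ = ≈-refl
    at-v : ∀ a → (if ⌊ compose a v ≟W w ⌋ then f a * δ v v else 0#) ≈
                 (if ⌊ compose a v ≟W w ⌋ then f a else 0#)
    at-v a with compose a v ≟W w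
    ... | yes _ = ≈-trans (*-congˡ (δ-diagonal v)) (*-identityʳ (f a))
    ... | no  _ = ≈-refl

  lrmFamily-diagonal : ∀ {v} → v ∈ Sn n → lrmFamily v v ≈ 1#
  lrmFamily-diagonal {v} v∈ = ≈-trans (⋆-δʳ (B (LRM' v)) v∈ v)
    (≈-trans (sumOver-single _ (Sn-unique n) identity∈ others) at-identity)
    where
    identity∈ : identity ∈ Sn n
    identity∈ = Equivalence.from ∈Sn⇔IsPermutation identity-isPermutation
    others : ∀ {a} → a ∈ Sn n → a ≢ identity →
      (if ⌊ compose a v ≟W v ⌋ then B (LRM' v) a else 0#) ≈ 0#
    others {a} _ a≢identity with compose a v ≟W v
    ... | yes av≡v = contradiction
                       (compose-fixed⇒identity (Equivalence.to ∈Sn⇔IsPermutation v∈) av≡v) a≢identity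
    ... | no  _    = ≈-refl
    at-identity : (if ⌊ compose identity v ≟W v ⌋ then B (LRM' v) identity else 0#) ≈ 1#
    at-identity with compose identity v ≟W v
    ... | yes _   = DesSub⇒B≈1 (DesSub-identity {n} (LRM' v))
    ... | no  ¬id = contradiction (compose-identityˡ v) ¬id

  lrmFamily-triangular : ∀ {v w} → v ∈ Sn n → w ∈ Sn n → v ≢ w → lrmFamily v w ≈ 0# ⊎ w <ˡᵉˣ v
  lrmFamily-triangular {v} {w} v∈ _ v≢w with Lex.<-decidable Fin._≟_ Fin._<?_ w v
  ... | yes w<v = inj₂ w<v
  ... | no  w≮v = inj₁ (≈-trans (⋆-δʳ (B (LRM' v)) v∈ w) (sumOver-zero (Sn n) vanish))
    where
    vanish : ∀ {a} → a ∈ Sn n → (if ⌊ compose a v ≟W w ⌋ then B (LRM' v) a else 0#) ≈ 0#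
    vanish {a} a∈ with compose a v ≟W w
    ... | no  _    = ≈-refl
    ... | yes av≡w with T? (DesSub a (LRM' v))
    ...   | no  ¬des = ¬DesSub⇒B≈0 ¬des
    ...   | yes des with compose-triangular (Equivalence.to ∈Sn⇔IsPermutation a∈)
                                            (Equivalence.to ∈Sn⇔IsPermutation v∈) des
    ...     | inj₁ av≡v = contradiction (trans (sym av≡v) av≡w) v≢w
    ...     | inj₂ av<v = contradiction (subst (_<ˡᵉˣ v) av≡w av<v) w≮v

corollary3p6 : ∀ {c ℓ : Level} (R : CommutativeRing c ℓ) (n : ℕ) → GroupAlgebra.IsBasis R n (GroupAlgebra.lrmFamily R n)
corollary3p6 R n = isBasis <ˡᵉˣ-wellFounded >ˡᵉˣ-wellFounded
  where
  open LinearAlgebra R (_≟W_ {n})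
  open Unitriangular (Sn n) (Sn-unique n) (GroupAlgebra.lrmFamily R n)
                     (lrmFamily-diagonal R n) (lrmFamily-triangular R n)
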